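{- Let $\alpha$ be a composition of $n$ and let $P$ be a standard immaculate tableau of shape $\alpha$ such that $\pi_i(P)=P$ for all $i\in\{1,2,\dots,n-1\}\setminus\mathcal{S}(\alpha)$, where $\pi_i$ acts on standard immaculate tableaux by: $\pi_i(T)=0$ if $i$ and $i+1$ are both in the first column of $T$; $\pi_i(T)=T$ if $i$ is in a row weakly below the row containing $i+1$; $\pi_i(T)=s_i(T)$ (swap entries $i$ and $i+1$) otherwise. Then $P=\hat{S}_\alpha$. In particular, if $P\neq\hat{S}_\alpha$ then there exists an $i$ such that $\pi_i(\hat{S}_\alpha)=\hat{S}_\alpha$ but $\pi_i(P)\neq P$.
   Context: A composition $\alpha=[\alpha_1,\dots,\alpha_m]$ of $n$ is a tuple of positive integers summing to $n$, with $\mathcal{S}(\alpha)=\{\alpha_1,\alpha_1+\alpha_2,\dots,\alpha_1+\cdots+\alpha_{m-1}\}$. Its diagram has left-justified rows of lengths $\alpha_1,\dots,\alpha_m$ top to bottom. A standard immaculate tableau of shape $\alpha$ is a filling of the diagram with $1,\dots,n$, each once, rows increasing left to right and first column increasing top to bottom. $\hat{S}_\alpha$ is the super-standard tableau: row $k$ contains $\alpha_1+\cdots+\alpha_{k-1}+1,\dots,\alpha_1+\cdots+\alpha_k$. -}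

module Defs where

open import Data.Nat using (ℕ; zero; suc; _+_; _≤_; _<_; _≡ᵇ_; _≟_; _≤?_)
open import Data.Bool using (Bool; true; false; if_then_else_)
open import Data.List using (List; []; _∷_; map; concat; upTo; length)
open import Data.Nat.ListAction using (sum)
open import Data.List.Relation.Unary.All using (All)
open import Data.List.Relation.Unary.Linked using (Linked)
open import Data.List.Relation.Binary.Permutation.Propositional using (_↭_)
open import Data.List.Membership.DecPropositional _≟_ using (_∈?_)
open import Data.List.Membership.Propositional using (_∈_)
open import Data.Maybe using (Maybe; just; nothing)
open import Data.Product using (_×_)
open import Relation.Nullary using (yes; no; ¬_)
open import Relation.Nullary.Decidable using (⌊_⌋)

IsComposition : List ℕ → Set
IsComposition α = All (λ a → 1 ≤ a) α

partialSums : List ℕ → List ℕ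
partialSums [] = []
partialSums (a ∷ []) = []
partialSums (a ∷ b ∷ rest) = a ∷ map (a +_) (partialSums (b ∷ rest))

-- A filling of a diagram: list of rows (top to bottom), each row left to right.
Tableau : Set
Tableau = List (List ℕ)

firstColumn : Tableau → List ℕ
firstColumn [] = []
firstColumn ([] ∷ rs) = firstColumn rs
firstColumn ((x ∷ _) ∷ rs) = x ∷ firstColumn rs

IsSIT : List ℕ → Tableau → Set
IsSIT α T =
  (map length T ≡ α)
  × (concat T ↭ map suc (upTo (sum α)))
  × All (Linked _<_) T
  × Linked _<_ (firstColumn T)
  where open import Relation.Binary.PropositionalEquality using (_≡_)

-- index (0 = top) of the first row containing x
rowOf : ℕ → Tableau → ℕ
rowOf x [] = 0
rowOf x (r ∷ rs) = if ⌊ x ∈? r ⌋ then 0 else suc (rowOf x rs)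

swapEntries : ℕ → Tableau → Tableau
swapEntries i = map (map (λ x → if x ≡ᵇ i then suc i else if x ≡ᵇ suc i then i else x))

-- π_i on standard immaculate tableaux; nothing represents 0
π : ℕ → Tableau → Maybe Tableau
π i T with i ∈? firstColumn T | suc i ∈? firstColumn T
... | yes _ | yes _ = nothing
... | _ | _ = if ⌊ rowOf (suc i) T ≤? rowOf i T ⌋ then just T else just (swapEntries i T)

superStandardFrom : ℕ → List ℕ → Tableau
superStandardFrom s [] = []
superStandardFrom s (a ∷ as) = map (λ j → s + suc j) (upTo a) ∷ superStandardFrom (s + a) as

superStandard : List ℕ → Tableau
superStandard = superStandardFrom 0

module Submission where

-- If π_i fixes P and i is an entry, then i+1 lies weakly above i, since otherwise π_i would
-- swap them. The least entry heads the top row, because the first column and all rows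
-- increase; and each i < α₁ is not in S(α), so i+1 lies weakly above i, i.e. in the top row
-- as well. The increasing top row of length α₁ is therefore 1, …, α₁, and the lower rows form
-- a standard immaculate tableau on α₁+1, …, n that again satisfies the hypothesis; induction
-- on the rows, with the entries offset by s, gives P = Ŝ_α. The second claim is then vacuous.

open import Defs
open import Data.Nat using (ℕ; zero; suc; _+_; _≤_; _<_; _≡ᵇ_; _≟_; _≤?_; z≤n; s≤s)
open import Data.Nat.Properties
open import Data.Nat.ListAction using (sum)
open import Data.Bool using (Bool; true; if_then_else_)
open import Data.List using (List; []; _∷_; map; concat; upTo; applyUpTo; length; _++_)
open import Data.List.Properties using (map-upTo; concat-map; ∷-injectiveˡ; ∷-injectiveʳ)
open import Data.List.Relation.Unary.All using (All; []; _∷_; lookup)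
open import Data.List.Relation.Unary.AllPairs using (_∷_)
open import Data.List.Relation.Unary.Any using (here; there)
open import Data.List.Relation.Unary.Linked using (Linked; _∷_; tail)
open import Data.List.Relation.Unary.Linked.Properties using (Linked⇒AllPairs)
open import Data.List.Relation.Binary.Permutation.Propositional using (_↭_; ↭-sym)
open import Data.List.Relation.Binary.Permutation.Propositional.Properties using (∈-resp-↭; drop-∷)
open import Data.List.Membership.Propositional using (_∈_; _∉_)
open import Data.List.Membership.Propositional.Properties using (∈-++⁻; ∈-++⁺ˡ; ∈-concat⁻′; ∈-map⁻)
open import Data.List.Membership.DecPropositional _≟_ using (_∈?_)
open import Data.Maybe using (just)
open import Data.Maybe.Properties using (just-injective)
open import Data.Product using (_×_; _,_; proj₁; proj₂; ∃-syntax)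
open import Data.Sum using (inj₁; inj₂)
open import Data.Empty using (⊥-elim)
open import Relation.Nullary using (¬_; yes; no)
open import Relation.Nullary.Decidable using (⌊_⌋)
open import Relation.Binary.PropositionalEquality
  using (_≡_; _≢_; refl; sym; trans; cong; cong₂; subst; subst₂; ≢-sym)

interval : ℕ → ℕ → List ℕ
interval s zero    = []
interval s (suc a) = suc s ∷ interval (suc s) a

∈-interval⁻ : ∀ {x} s a → x ∈ interval s a → s < x × x ≤ a + s
∈-interval⁻ s (suc a) (here refl) = ≤-refl , s≤s (m≤n+m s a)
∈-interval⁻ {x} s (suc a) (there x∈) with ∈-interval⁻ (suc s) a x∈
... | s<x , x≤ = <-trans (n<1+n s) s<x , subst (x ≤_) (+-suc a s) x≤

∈-interval⁺ : ∀ {x} s a → s < x → x ≤ a + s → x ∈ interval s a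
∈-interval⁺ s zero s<x x≤s = ⊥-elim (<⇒≱ s<x x≤s)
∈-interval⁺ {x} s (suc a) s<x x≤ with x ≟ suc s
... | yes refl = here refl
... | no x≢ =
  there (∈-interval⁺ (suc s) a (≤∧≢⇒< s<x (≢-sym x≢)) (subst (x ≤_) (sym (+-suc a s)) x≤))

interval-+ : ∀ s a b → interval s (a + b) ≡ interval s a ++ interval (a + s) b
interval-+ s zero    b = refl
interval-+ s (suc a) b rewrite interval-+ (suc s) a b | +-suc a s = refl

applyUpTo-interval : ∀ a s (f : ℕ → ℕ) → (∀ j → f j ≡ s + suc j) → applyUpTo f a ≡ interval s a
applyUpTo-interval zero    s f f≗ = refl
applyUpTo-interval (suc a) s f f≗ =
  cong₂ _∷_ (trans (f≗ 0) (+-comm s 1))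
            (applyUpTo-interval a (suc s) (λ j → f (suc j)) (λ j → trans (f≗ (suc j)) (+-suc s (suc j))))

map-upTo-interval : ∀ s a → map (λ j → s + suc j) (upTo a) ≡ interval s a
map-upTo-interval s a = trans (map-upTo _ a) (applyUpTo-interval a s _ (λ _ → refl))

++-cancelˡ-↭ : ∀ (xs : List ℕ) {ys zs} → xs ++ ys ↭ xs ++ zs → ys ↭ zs
++-cancelˡ-↭ []       p = p
++-cancelˡ-↭ (x ∷ xs) p = ++-cancelˡ-↭ xs (drop-∷ p)

head<∈tail : ∀ {x y ys} → Linked _<_ (x ∷ ys) → y ∈ ys → x < y
head<∈tail lk y∈ with Linked⇒AllPairs <-trans lk
... | x<ys ∷ _ = lookup x<ys y∈

head≤∈ : ∀ {x y ys} → Linked _<_ (x ∷ ys) → y ∈ x ∷ ys → x ≤ y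
head≤∈ _  (here refl) = ≤-refl
head≤∈ lk (there y∈)  = <⇒≤ (head<∈tail lk y∈)

map-fixes-∈ : ∀ {f : ℕ → ℕ} {x} xs → map f xs ≡ xs → x ∈ xs → f x ≡ x
map-fixes-∈ (_ ∷ _)  fxs≡ (here refl) = ∷-injectiveˡ fxs≡
map-fixes-∈ (_ ∷ xs) fxs≡ (there x∈)  = map-fixes-∈ xs (∷-injectiveʳ fxs≡) x∈

∈-firstColumn : ∀ {x xs} (T : Tableau) → (x ∷ xs) ∈ T → x ∈ firstColumn T
∈-firstColumn (_ ∷ _)         (here refl) = here refl
∈-firstColumn ([] ∷ T)        (there r∈)  = ∈-firstColumn T r∈
∈-firstColumn ((_ ∷ _) ∷ T)   (there r∈)  = there (∈-firstColumn T r∈)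

firstColumn-tail : ∀ r (T : Tableau) → Linked _<_ (firstColumn (r ∷ T)) → Linked _<_ (firstColumn T)
firstColumn-tail []      T lk = lk
firstColumn-tail (_ ∷ _) T lk = tail lk

rowOf-∈ : ∀ {x} r T → x ∈ r → rowOf x (r ∷ T) ≡ 0
rowOf-∈ {x} r T x∈ with x ∈? r
... | yes _ = refl
... | no x∉ = ⊥-elim (x∉ x∈)

rowOf-∉ : ∀ {x} r T → x ∉ r → rowOf x (r ∷ T) ≡ suc (rowOf x T)
rowOf-∉ {x} r T x∉ with x ∈? r
... | yes x∈ = ⊥-elim (x∉ x∈)
... | no _ = refl

rowOf≤0⇒∈ : ∀ {x} r T → rowOf x (r ∷ T) ≤ 0 → x ∈ r
rowOf≤0⇒∈ {x} r T row≤0 with x ∈? r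
... | yes x∈ = x∈
... | no _ with row≤0
...   | ()

≡ᵇ-refl : ∀ i → (i ≡ᵇ i) ≡ true
≡ᵇ-refl zero    = refl
≡ᵇ-refl (suc i) = ≡ᵇ-refl i

swapEntries-moves : ∀ i T → i ∈ concat T → swapEntries i T ≢ T
swapEntries-moves i T i∈ sT≡T = 1+n≢n (subst (λ b → σ b ≡ i) (≡ᵇ-refl i) σi≡i)
  where
  σ : Bool → ℕ
  σ b = if b then suc i else if i ≡ᵇ suc i then i else i
  σi≡i : σ (i ≡ᵇ i) ≡ i
  σi≡i = map-fixes-∈ (concat T) (trans (sym (concat-map T)) (cong concat sT≡T)) i∈

unswapped⇒rowOf-suc≤ : ∀ i T → i ∈ concat T →
  (if ⌊ rowOf (suc i) T ≤? rowOf i T ⌋ then just T else just (swapEntries i T)) ≡ just T →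
  rowOf (suc i) T ≤ rowOf i T
unswapped⇒rowOf-suc≤ i T i∈ eq with rowOf (suc i) T ≤? rowOf i T
... | yes ≤ = ≤
... | no  _ = ⊥-elim (swapEntries-moves i T i∈ (just-injective eq))

π-fixed⇒rowOf-suc≤ : ∀ i T → i ∈ concat T → π i T ≡ just T → rowOf (suc i) T ≤ rowOf i T
π-fixed⇒rowOf-suc≤ i T i∈ πT≡T with i ∈? firstColumn T | suc i ∈? firstColumn T
π-fixed⇒rowOf-suc≤ i T i∈ () | yes _ | yes _
... | yes _ | no  _ = unswapped⇒rowOf-suc≤ i T i∈ πT≡T
... | no  _ | yes _ = unswapped⇒rowOf-suc≤ i T i∈ πT≡T
... | no  _ | no  _ = unswapped⇒rowOf-suc≤ i T i∈ πT≡T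

<head⇒∉partialSums : ∀ {j a} as → j < a → j ∉ partialSums (a ∷ as)
<head⇒∉partialSums (_ ∷ _) j<a (here refl) = <-irrefl refl j<a
<head⇒∉partialSums {a = a} (_ ∷ _) j<a (there j∈) with ∈-map⁻ (a +_) j∈
... | y , _ , refl = <-irrefl refl (≤-trans j<a (m≤m+n a y))

+-∉partialSums : ∀ {k} a as → 1 ≤ k → k ∉ partialSums as → a + k ∉ partialSums (a ∷ as)
+-∉partialSums {k} a (_ ∷ _) 1≤k _ (here a+k≡a) =
  <⇒≢ 1≤k (sym (+-cancelˡ-≡ a k 0 (trans a+k≡a (sym (+-identityʳ a)))))
+-∉partialSums {k} a (_ ∷ _) _ k∉ (there a+k∈) with ∈-map⁻ (a +_) a+k∈
... | y , y∈ , a+k≡a+y = k∉ (subst (_∈ _) (sym (+-cancelˡ-≡ a k y a+k≡a+y)) y∈)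

IsSITFrom : ℕ → List ℕ → Tableau → Set
IsSITFrom s α T =
  map length T ≡ α × concat T ↭ interval s (sum α) × All (Linked _<_) T × Linked _<_ (firstColumn T)

SuccWeaklyAbove : ℕ → List ℕ → Tableau → Set
SuccWeaklyAbove s α T =
  ∀ k → 1 ≤ k → k < sum α → k ∉ partialSums α → rowOf (suc (s + k)) T ≤ rowOf (s + k) T

corner<lowerRows : ∀ {x y} T → Linked _<_ (x ∷ firstColumn T) → All (Linked _<_) T →
                   y ∈ concat T → x < y
corner<lowerRows T fc rows y∈ with ∈-concat⁻′ T y∈
... | (_ ∷ _) , y∈row , row∈ =
  <-≤-trans (head<∈tail fc (∈-firstColumn T row∈)) (head≤∈ (lookup rows row∈) y∈row)

suc∈topRow : ∀ {s x r n} T → concat ((x ∷ r) ∷ T) ↭ interval s (suc n) → All (Linked _<_) T →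
             Linked _<_ (firstColumn ((x ∷ r) ∷ T)) → suc s ∈ x ∷ r
suc∈topRow {s} {x} {r} {n} T perm rows fc with ∈-++⁻ (x ∷ r) (∈-resp-↭ (↭-sym perm) (here refl))
... | inj₁ s+1∈r = s+1∈r
... | inj₂ s+1∈T = ⊥-elim (<⇒≱ s<x (≤-pred (corner<lowerRows T fc rows s+1∈T)))
  where s<x = proj₁ (∈-interval⁻ s (suc n) (∈-resp-↭ perm (here refl)))

increasing-⊇interval⇒≡ : ∀ s a r → Linked _<_ r → length r ≡ a → (∀ x → x ∈ r → s < x) →
                         (∀ j → j < a → suc (j + s) ∈ r) → r ≡ interval s a
increasing-⊇interval⇒≡ s zero    []      _  _  _     _ = refl
increasing-⊇interval⇒≡ s (suc a) (x ∷ r) lk |r| above ⊇ with ⊇ 0 (s≤s z≤n)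
... | there s+1∈r = ⊥-elim (<⇒≱ (above x (here refl)) (≤-pred (head<∈tail lk s+1∈r)))
... | here refl   = cong (suc s ∷_)
  (increasing-⊇interval⇒≡ (suc s) a r (tail lk) (suc-injective |r|) (λ _ → head<∈tail lk) ⊇′)
  where
  ⊇′ : ∀ j → j < a → suc (j + suc s) ∈ r
  ⊇′ j j<a with ⊇ (suc j) (s≤s j<a)
  ... | here eq   = ⊥-elim (<-irrefl (sym (suc-injective eq)) (s≤s (m≤n+m s j)))
  ... | there j∈r = subst (_∈ r) (cong suc (sym (+-suc j s))) j∈r

topRow≡interval : ∀ s r T {α} → 1 ≤ length r → IsSITFrom s (length r ∷ α) (r ∷ T) →
                  SuccWeaklyAbove s (length r ∷ α) (r ∷ T) → r ≡ interval s (length r)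
topRow≡interval s r@(_ ∷ _) T {α} _ (_ , perm , r-inc ∷ rows , fc) above =
  increasing-⊇interval⇒≡ s (length r) r r-inc refl
    (λ _ x∈r → proj₁ (∈-interval⁻ s _ (∈-resp-↭ perm (∈-++⁺ˡ x∈r)))) ⊇
  where
  ⊇ : ∀ j → j < length r → suc (j + s) ∈ r
  ⊇ zero    _       = suc∈topRow T perm rows fc
  ⊇ (suc j) j+1<a =
    rowOf≤0⇒∈ r T (subst (rowOf (suc (suc (j + s))) (r ∷ T) ≤_) j+s+1-inTop j+s+2-weaklyAbove)
    where
    j+s+1-inTop : rowOf (suc (j + s)) (r ∷ T) ≡ 0
    j+s+1-inTop = rowOf-∈ r T (⊇ j (<-trans (n<1+n j) j+1<a))
    s+j+1≡ : s + suc j ≡ suc (j + s)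
    s+j+1≡ = trans (+-suc s j) (cong suc (+-comm s j))
    j+s+2-weaklyAbove : rowOf (suc (suc (j + s))) (r ∷ T) ≤ rowOf (suc (j + s)) (r ∷ T)
    j+s+2-weaklyAbove = subst (λ i → rowOf (suc i) (r ∷ T) ≤ rowOf i (r ∷ T)) s+j+1≡
      (above (suc j) (s≤s z≤n) (≤-trans j+1<a (m≤m+n _ _)) (<head⇒∉partialSums α j+1<a))

lowerRows-↭ : ∀ s a M T → concat (interval s a ∷ T) ↭ interval s (a + M) →
              concat T ↭ interval (s + a) M
lowerRows-↭ s a M T perm =
  subst (λ t → concat T ↭ interval t M) (+-comm a s)
    (++-cancelˡ-↭ (interval s a) (subst (_ ↭_) (interval-+ s a M) perm))

SuccWeaklyAbove-lowerRows : ∀ s r T α → r ≡ interval s (length r) →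
  SuccWeaklyAbove s (length r ∷ α) (r ∷ T) → SuccWeaklyAbove (s + length r) α T
SuccWeaklyAbove-lowerRows s r T α r≡ above k 1≤k k<Σα k∉ =
  ≤-pred (subst₂ _≤_ (rowOf-∉ r T (beyondTop (m<n⇒m<1+n s+a<s+a+k)))
                     (rowOf-∉ r T (beyondTop s+a<s+a+k)) step)
  where
  a = length r
  s+a<s+a+k : s + a < s + a + k
  s+a<s+a+k = m<m+n (s + a) 1≤k
  beyondTop : ∀ {y} → s + a < y → y ∉ r
  beyondTop {y} s+a<y y∈r =
    <⇒≱ s+a<y (subst (y ≤_) (+-comm a s) (proj₂ (∈-interval⁻ s a (subst (_ ∈_) r≡ y∈r))))
  step : rowOf (suc (s + a + k)) (r ∷ T) ≤ rowOf (s + a + k) (r ∷ T)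
  step = subst (λ i → rowOf (suc i) (r ∷ T) ≤ rowOf i (r ∷ T)) (sym (+-assoc s a k))
           (above (a + k) (≤-trans 1≤k (m≤n+m k a)) (+-monoʳ-< a k<Σα) (+-∉partialSums a α 1≤k k∉))

superStandardFrom-unique : ∀ s α T → All (1 ≤_) α → IsSITFrom s α T → SuccWeaklyAbove s α T →
                           T ≡ superStandardFrom s α
superStandardFrom-unique s [] [] _ _ _ = refl
superStandardFrom-unique s (.(length r) ∷ .(map length T)) (r ∷ T) (1≤a ∷ pos)
                         sit@(refl , perm , _ ∷ rows , fc) above =
  cong₂ _∷_ (trans r≡ (sym (map-upTo-interval s (length r))))
    (superStandardFrom-unique (s + length r) (map length T) T pos
      (refl , lowerRows-↭ s (length r) M T perm′ , rows , firstColumn-tail r T fc)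
      (SuccWeaklyAbove-lowerRows s r T (map length T) r≡ above))
  where
  M = sum (map length T)
  r≡ : r ≡ interval s (length r)
  r≡ = topRow≡interval s r T 1≤a sit above
  perm′ : concat (interval s (length r) ∷ T) ↭ interval s (length r + M)
  perm′ = subst (λ r′ → concat (r′ ∷ T) ↭ interval s (length r + M)) r≡ perm

lemma3p11 : (α : List ℕ) → IsComposition α → (P : Tableau) → IsSIT α P →
    (∀ i → 1 ≤ i → i < sum α → ¬ (i ∈ partialSums α) → π i P ≡ just P) →
    (P ≡ superStandard α)
      × (P ≢ superStandard α →
           ∃[ i ] (1 ≤ i × i < sum α × π i (superStandard α) ≡ just (superStandard α) × π i P ≢ just P))
lemma3p11 α composition P (shape , perm , rows , fc) π-fixed = P≡Ŝ , λ P≢Ŝ → ⊥-elim (P≢Ŝ P≡Ŝ)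
  where
  perm₀ : concat P ↭ interval 0 (sum α)
  perm₀ = subst (concat P ↭_) (map-upTo-interval 0 (sum α)) perm
  entry : ∀ k → 1 ≤ k → k < sum α → k ∈ concat P
  entry k 1≤k k<n =
    ∈-resp-↭ (↭-sym perm₀) (∈-interval⁺ 0 (sum α) 1≤k (subst (k ≤_) (sym (+-identityʳ _)) (<⇒≤ k<n)))
  above : SuccWeaklyAbove 0 α P
  above k 1≤k k<n k∉ = π-fixed⇒rowOf-suc≤ k P (entry k 1≤k k<n) (π-fixed k 1≤k k<n k∉)
  P≡Ŝ : P ≡ superStandard α
  P≡Ŝ = superStandardFrom-unique 0 α P composition (shape , perm₀ , rows , fc) above
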